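{- For all $n\ge1$, the partial order $\Omega_n$ is a pre-shelling of the order complex $\Delta(J(\mathbf{2}\times\mathbf{n}))$, whose facets are identified with $\mathcal{D}_n$.
   Context: $\mathcal{D}_n$ is the set of Dyck paths $w=a_1\cdots a_{2n}$ (words in $v,h$, $n$ of each, every prefix having at least as many $v$'s as $h$'s), viewed as lattice paths from $(0,0)$ to $(n,n)$ with $v=(0,1)$, $h=(1,0)$. The lattice $J(\mathbf{2}\times\mathbf{n})$ of order ideals of the product of chains $\{1<2\}\times\{1<\dots<n\}$ is isomorphic to the set of lattice points $\{(x,y):0\le x\le y\le n\}$ with componentwise order; its order complex $\Delta(J(\mathbf{2}\times\mathbf{n}))$ is the simplicial complex of all chains. Its facets (maximal chains) are exactly the sets of $2n+1$ lattice points visited by Dyck paths, and a Dyck path is identified with the facet consisting of the points $a_1+\dots+a_i$, $0\le i\le 2n$. For $1\le i\le 2n-2$, $s_i(w)$ replaces $a_ia_{i+1}a_{i+2}$ by $vhv$ if it equals $vvh$, by $hvh$ if it equals $hhv$, and leaves $w$ unchanged otherwise. $u<_{\Omega_n}w$ iff $u\ne w$ and $u=\sigma_1\cdots\sigma_k(w)$ for some $k\ge1$ and $\sigma_j\in\{s_1,\dots,s_{2n-2}\}$; this is a partial order on $\mathcal{D}_n$. For a partial order $\Omega$ on the facets of a pure simplicial complex, $r_\Omega(F)=\{x\in F:\exists\text{ facet }E<_\Omega F\text{ with }E\cap F=F\setminus\{x\}\}$, and $\Omega$ is a pre-shelling if for all facets $F,G$, $r_\Omega(F)\subseteq G$ and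 $r_\Omega(G)\subseteq F$ imply $F=G$ (equivalently: whenever $F\not\ge_\Omega G$ there are $x\in G$ and a facet $E<_\Omega G$ with $F\cap G\subseteq E\cap G=G\setminus\{x\}$). -}

module Defs where

open import Data.Nat using (ℕ; zero; suc; _+_; _*_; _∸_; _≤_)
open import Data.List using (List; []; _∷_; length; take)
open import Data.List.Membership.Propositional using (_∈_)
open import Data.List.Relation.Unary.All using (All)
open import Data.Product using (Σ; _×_; _,_)
open import Relation.Binary.PropositionalEquality using (_≡_; _≢_)

-- Letters: v = (0,1), h = (1,0)
data Step : Set where
  v h : Step

#v : List Step → ℕ
#v [] = 0
#v (v ∷ w) = suc (#v w)
#v (h ∷ w) = #v w

#h : List Step → ℕ
#h [] = 0
#h (v ∷ w) = #h w
#h (h ∷ w) = suc (#h w)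

record Dyck (n : ℕ) : Set where
  constructor dyck
  field
    word     : List Step
    countV   : #v word ≡ n
    countH   : #h word ≡ n
    prefixes : ∀ k → #h (take k word) ≤ #v (take k word)
open Dyck public

Point : Set
Point = ℕ × ℕ

pointsFrom : Point → List Step → List Point
pointsFrom p [] = p ∷ []
pointsFrom (x , y) (v ∷ w) = (x , y) ∷ pointsFrom (x , suc y) w
pointsFrom (x , y) (h ∷ w) = (x , y) ∷ pointsFrom (suc x , y) w

-- the facet (maximal chain of J(2×n)) associated with a Dyck path
facet : ∀ {n} → Dyck n → List Point
facet F = pointsFrom (0 , 0) (word F)

-- s at 0-indexed position k acts on letters k, k+1, k+2
sAt : ℕ → List Step → List Step
sAt zero (v ∷ v ∷ h ∷ r) = v ∷ h ∷ v ∷ r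
sAt zero (h ∷ h ∷ v ∷ r) = h ∷ v ∷ h ∷ r
sAt zero w = w
sAt (suc k) [] = []
sAt (suc k) (a ∷ w) = a ∷ sAt k w

-- the paper's s_i (1-indexed, i ≥ 1): acts on a_i a_{i+1} a_{i+2}
s : ℕ → List Step → List Step
s i w = sAt (i ∸ 1) w

applyAll : List ℕ → List Step → List Step
applyAll [] w = w
applyAll (i ∷ is) w = s i (applyAll is w)

InRange : ℕ → ℕ → Set
InRange n i = (1 ≤ i) × (i ≤ 2 * n ∸ 2)

_<Ω[_]_ : List Step → ℕ → List Step → Set
u <Ω[ n ] w = (u ≢ w) × Σ (List ℕ) λ is →
  (1 ≤ length is) × All (InRange n) is × (u ≡ applyAll is w)

IntersectIsDelete : List Point → List Point → Point → Set
IntersectIsDelete E F x =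
  ∀ p → ((p ∈ E × p ∈ F) → (p ∈ F × p ≢ x)) × ((p ∈ F × p ≢ x) → (p ∈ E × p ∈ F))

InR : (n : ℕ) → Dyck n → Point → Set
InR n F x = (x ∈ facet F) × Σ (Dyck n) λ E →
  (word E <Ω[ n ] word F) × IntersectIsDelete (facet E) (facet F) x

RSubset : (n : ℕ) → Dyck n → Dyck n → Set
RSubset n F G = ∀ x → InR n F x → x ∈ facet G

IsPreShelling : ℕ → Set
IsPreShelling n = ∀ (F G : Dyck n) → RSubset n F G → RSubset n G F → word F ≡ word G

-- Suppose r(F) ⊆ G and r(G) ⊆ F but F ≠ G. Both words start with v, so they
-- first differ just after a common nonempty prefix ending in some letter a:
-- one of them, X, continues with a, the other, Y, with the opposite letter ā.
-- Since X and Y contain equally many ā, the run of a's in X ends in a peak aaā,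
-- and the single move aaā ↦ aāa deletes exactly the corner of that peak, which
-- therefore lies in r(X) ⊆ Y. But the corner lies on the line through the
-- branch point in direction a, which Y has already left for good: contradiction.
module Submission where

open import Defs
open import Data.Nat using (ℕ; zero; suc; _+_; _*_; _∸_; _≤_; z≤n; s≤s; s≤s⁻¹)
open import Data.Nat.Properties
  using (≤-refl; ≤-trans; ≤-reflexive; n≤1+n; <⇒≱; 1+n≰n; +-suc; +-identityʳ; +-cancelˡ-≡; ∸-monoˡ-≤; suc-injective)
open import Data.List using (List; []; _∷_; _++_; length; take)
open import Data.List.Properties using (++-assoc; ++-cancelˡ; ∷-injectiveˡ; ∷-injectiveʳ)
open import Data.List.Membership.Propositional using (_∈_; _∉_)
open import Data.List.Membership.Propositional.Properties using (∈-++⁺ʳ; ∈-++⁻)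
open import Data.List.Relation.Unary.Any using (here; there)
open import Data.List.Relation.Unary.All using ([]; _∷_)
open import Data.Product using (Σ; _×_; _,_)
open import Data.Sum using (_⊎_; inj₁; inj₂; map)
open import Data.Unit using (⊤; tt)
open import Data.Empty using (⊥; ⊥-elim)
open import Relation.Nullary using (¬_)
open import Function using (_∘′_)
open import Relation.Binary.PropositionalEquality
  using (_≡_; _≢_; refl; sym; trans; cong; cong₂; subst; subst₂; module ≡-Reasoning)

open ≡-Reasoning

opp : Step → Step
opp v = h
opp h = v

opp≢ : ∀ a → opp a ≢ a
opp≢ v ()
opp≢ h ()

≡-or-opp : ∀ a b → b ≡ a ⊎ b ≡ opp a
≡-or-opp v v = inj₁ refl
≡-or-opp v h = inj₂ refl
≡-or-opp h h = inj₁ refl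
≡-or-opp h v = inj₂ refl

count : Step → List Step → ℕ
count v = #v
count h = #h

count-∷-self : ∀ a w → count a (a ∷ w) ≡ suc (count a w)
count-∷-self v w = refl
count-∷-self h w = refl

count-∷-opp : ∀ a w → count (opp a) (a ∷ w) ≡ count (opp a) w
count-∷-opp v w = refl
count-∷-opp h w = refl

count-++ : ∀ a P w → count a (P ++ w) ≡ count a P + count a w
count-++ v []      w = refl
count-++ v (v ∷ P) w = cong suc (count-++ v P w)
count-++ v (h ∷ P) w = count-++ v P w
count-++ h []      w = refl
count-++ h (v ∷ P) w = count-++ h P w
count-++ h (h ∷ P) w = cong suc (count-++ h P w)

count-peakFlip : ∀ a b r → count b (a ∷ opp a ∷ a ∷ r) ≡ count b (a ∷ a ∷ opp a ∷ r)
count-peakFlip v v r = refl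
count-peakFlip v h r = refl
count-peakFlip h v r = refl
count-peakFlip h h r = refl

count≡suc⇒∈ : ∀ a w {m} → count a w ≡ suc m → a ∈ w
count≡suc⇒∈ v (v ∷ w) _ = here refl
count≡suc⇒∈ v (h ∷ w) c = there (count≡suc⇒∈ v w c)
count≡suc⇒∈ h (h ∷ w) _ = here refl
count≡suc⇒∈ h (v ∷ w) c = there (count≡suc⇒∈ h w c)

length≡#v+#h : ∀ w → length w ≡ #v w + #h w
length≡#v+#h []      = refl
length≡#v+#h (v ∷ w) = cong suc (length≡#v+#h w)
length≡#v+#h (h ∷ w) = trans (cong suc (length≡#v+#h w)) (sym (+-suc (#v w) (#h w)))

-- The prefix condition of a word started at height d, as a structural predicate.
Ballot : ℕ → List Step → Set
Ballot d       []      = ⊤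
Ballot d       (v ∷ w) = Ballot (suc d) w
Ballot zero    (h ∷ w) = ⊥
Ballot (suc d) (h ∷ w) = Ballot d w

prefixes⇒Ballot : ∀ d w → (∀ k → #h (take k w) ≤ d + #v (take k w)) → Ballot d w
prefixes⇒Ballot d       []      _   = tt
prefixes⇒Ballot d       (v ∷ w) pre =
  prefixes⇒Ballot (suc d) w (λ k → subst (#h (take k w) ≤_) (+-suc d _) (pre (suc k)))
prefixes⇒Ballot zero    (h ∷ w) pre with pre 1
... | ()
prefixes⇒Ballot (suc d) (h ∷ w) pre = prefixes⇒Ballot d w (λ k → s≤s⁻¹ (pre (suc k)))

Ballot⇒prefixes : ∀ d w → Ballot d w → ∀ k → #h (take k w) ≤ d + #v (take k w)
Ballot⇒prefixes d       w       _ zero    = z≤n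
Ballot⇒prefixes d       []      _ (suc k) = z≤n
Ballot⇒prefixes d       (v ∷ w) b (suc k) =
  subst (#h (take k w) ≤_) (sym (+-suc d _)) (Ballot⇒prefixes (suc d) w b k)
Ballot⇒prefixes (suc d) (h ∷ w) b (suc k) = s≤s (Ballot⇒prefixes d w b k)

Ballot-++ : ∀ P {u u′} → (∀ {d} → Ballot d u → Ballot d u′) → ∀ {d} → Ballot d (P ++ u) → Ballot d (P ++ u′)
Ballot-++ []      f b = f b
Ballot-++ (v ∷ P) f {d}     b = Ballot-++ P f {suc d} b
Ballot-++ (h ∷ P) f {suc d} b = Ballot-++ P f {d} b

Ballot-peakFlip : ∀ a r {d} → Ballot d (a ∷ a ∷ opp a ∷ r) → Ballot d (a ∷ opp a ∷ a ∷ r)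
Ballot-peakFlip v r b = b
Ballot-peakFlip h r {suc (suc d)} b = b

length-word : ∀ {n} (F : Dyck n) → length (word F) ≡ 2 * n
length-word {n} F = begin
  length (word F)           ≡⟨ length≡#v+#h (word F) ⟩
  #v (word F) + #h (word F) ≡⟨ cong₂ _+_ (countV F) (countH F) ⟩
  n + n                     ≡⟨ cong (n +_) (sym (+-identityʳ n)) ⟩
  2 * n                     ∎

length-agree : ∀ {n} (F G : Dyck n) → length (word F) ≡ length (word G)
length-agree F G = trans (length-word F) (sym (length-word G))

count-word : ∀ {n} (F : Dyck n) a → count a (word F) ≡ n
count-word F v = countV F
count-word F h = countH F

word-startsWith-v : ∀ {n} (F : Dyck n) → 1 ≤ n → Σ (List Step) λ f → word F ≡ v ∷ f
word-startsWith-v F 1≤n with word F | countV F | prefixes⇒Ballot 0 (word F) (prefixes F)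
... | []    | 0≡n | _  = ⊥-elim (1+n≰n (subst (1 ≤_) (sym 0≡n) 1≤n))
... | v ∷ f | _   | _  = f , refl
... | h ∷ f | _   | ()

peakFlip : ∀ {n} (G : Dyck n) P a r → word G ≡ P ++ a ∷ a ∷ opp a ∷ r → Dyck n
peakFlip {n} G P a r eq = dyck w′ (counts v) (counts h) (Ballot⇒prefixes 0 w′ ballot)
  where
  w′ = P ++ a ∷ opp a ∷ a ∷ r
  counts : ∀ b → count b w′ ≡ n
  counts b = begin
    count b w′                                ≡⟨ count-++ b P _ ⟩
    count b P + count b (a ∷ opp a ∷ a ∷ r)   ≡⟨ cong (count b P +_) (count-peakFlip a b r) ⟩
    count b P + count b (a ∷ a ∷ opp a ∷ r)   ≡⟨ count-++ b P _ ⟨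
    count b (P ++ a ∷ a ∷ opp a ∷ r)          ≡⟨ cong (count b) eq ⟨
    count b (word G)                          ≡⟨ count-word G b ⟩
    n                                         ∎
  ballot : Ballot 0 w′
  ballot = Ballot-++ P (Ballot-peakFlip a r) (subst (Ballot 0) eq (prefixes⇒Ballot 0 (word G) (prefixes G)))

sAt-++ : ∀ P w → sAt (length P) (P ++ w) ≡ P ++ sAt 0 w
sAt-++ []      w = refl
sAt-++ (x ∷ P) w = cong (x ∷_) (sAt-++ P w)

sAt-peak : ∀ a r → sAt 0 (a ∷ a ∷ opp a ∷ r) ≡ a ∷ opp a ∷ a ∷ r
sAt-peak v r = refl
sAt-peak h r = refl

3+length≤length-++ : ∀ P (a b c : Step) r → 3 + length P ≤ length (P ++ a ∷ b ∷ c ∷ r)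
3+length≤length-++ []      a b c r = s≤s (s≤s (s≤s z≤n))
3+length≤length-++ (x ∷ P) a b c r = s≤s (3+length≤length-++ P a b c r)

peakFlip-<Ω : ∀ {n} P a r {w} → w ≡ P ++ a ∷ a ∷ opp a ∷ r → length w ≡ 2 * n →
              (P ++ a ∷ opp a ∷ a ∷ r) <Ω[ n ] w
peakFlip-<Ω {n} P a r refl len = distinct , suc (length P) ∷ [] , s≤s z≤n , (s≤s z≤n , inRange) ∷ [] , sym moved
  where
  distinct : P ++ a ∷ opp a ∷ a ∷ r ≢ P ++ a ∷ a ∷ opp a ∷ r
  distinct eq = opp≢ a (∷-injectiveˡ (∷-injectiveʳ (++-cancelˡ P _ _ eq)))
  inRange : suc (length P) ≤ 2 * n ∸ 2
  inRange = subst (λ m → suc (length P) ≤ m ∸ 2) len (∸-monoˡ-≤ 2 (3+length≤length-++ P a a (opp a) r))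
  moved : s (suc (length P)) (P ++ a ∷ a ∷ opp a ∷ r) ≡ P ++ a ∷ opp a ∷ a ∷ r
  moved = trans (sAt-++ P _) (cong (P ++_) (sAt-peak a r))

origin : Point
origin = 0 , 0

move : Step → Point → Point
move v (x , y) = x , suc y
move h (x , y) = suc x , y

move-comm : ∀ a b q → move a (move b q) ≡ move b (move a q)
move-comm v v q = refl
move-comm v h q = refl
move-comm h v q = refl
move-comm h h q = refl

endFrom : Point → List Step → Point
endFrom q []      = q
endFrom q (a ∷ w) = endFrom (move a q) w

endFrom-∷ʳ : ∀ q P a → endFrom q (P ++ a ∷ []) ≡ move a (endFrom q P)
endFrom-∷ʳ q []      a = refl
endFrom-∷ʳ q (b ∷ P) a = endFrom-∷ʳ (move b q) P a

trail : Point → List Step → List Point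
trail q []      = []
trail q (a ∷ w) = q ∷ trail (move a q) w

pointsFrom-∷ : ∀ q a w → pointsFrom q (a ∷ w) ≡ q ∷ pointsFrom (move a q) w
pointsFrom-∷ q v w = refl
pointsFrom-∷ q h w = refl

pointsFrom-++ : ∀ q P w → pointsFrom q (P ++ w) ≡ trail q P ++ pointsFrom (endFrom q P) w
pointsFrom-++ q []      w = refl
pointsFrom-++ q (a ∷ P) w = trans (pointsFrom-∷ q a (P ++ w)) (cong (q ∷_) (pointsFrom-++ (move a q) P w))

pointsFrom-window : ∀ q P a b c r → let e = endFrom q P in
  pointsFrom q (P ++ a ∷ b ∷ c ∷ r)
    ≡ (trail q P ++ e ∷ move a e ∷ []) ++ move b (move a e) ∷ pointsFrom (move c (move b (move a e))) r
pointsFrom-window q P a b c r = begin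
  pointsFrom q (P ++ a ∷ b ∷ c ∷ r)                     ≡⟨ pointsFrom-++ q P _ ⟩
  trail q P ++ pointsFrom e (a ∷ b ∷ c ∷ r)              ≡⟨ cong (trail q P ++_) window ⟩
  trail q P ++ e ∷ e₁ ∷ e₂ ∷ pointsFrom (move c e₂) r     ≡⟨ ++-assoc (trail q P) _ _ ⟨
  (trail q P ++ e ∷ e₁ ∷ []) ++ e₂ ∷ pointsFrom (move c e₂) r ∎
  where
  e  = endFrom q P
  e₁ = move a e
  e₂ = move b e₁
  window : pointsFrom e (a ∷ b ∷ c ∷ r) ≡ e ∷ e₁ ∷ e₂ ∷ pointsFrom (move c e₂) r
  window = trans (pointsFrom-∷ e a _) (cong (e ∷_)
             (trans (pointsFrom-∷ e₁ b _) (cong (e₁ ∷_) (pointsFrom-∷ e₂ c r))))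

coord : Step → Point → ℕ
coord v (x , y) = y
coord h (x , y) = x

coord-move-self : ∀ a q → coord a (move a q) ≡ suc (coord a q)
coord-move-self v q = refl
coord-move-self h q = refl

coord-move-opp : ∀ a q → coord (opp a) (move a q) ≡ coord (opp a) q
coord-move-opp v q = refl
coord-move-opp h q = refl

coord-move-≤ : ∀ a b q → coord b q ≤ coord b (move a q)
coord-move-≤ v v q = n≤1+n _
coord-move-≤ v h q = ≤-refl
coord-move-≤ h v q = ≤-refl
coord-move-≤ h h q = n≤1+n _

coord-endFrom-≤ : ∀ b q w → coord b q ≤ coord b (endFrom q w)
coord-endFrom-≤ b q []      = ≤-refl
coord-endFrom-≤ b q (a ∷ w) = ≤-trans (coord-move-≤ a b q) (coord-endFrom-≤ b (move a q) w)

trail-≤-endFrom : ∀ b q w {p} → p ∈ trail q w → coord b p ≤ coord b (endFrom q w)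
trail-≤-endFrom b q (a ∷ w) (here refl) = coord-endFrom-≤ b q (a ∷ w)
trail-≤-endFrom b q (a ∷ w) (there p∈) = trail-≤-endFrom b (move a q) w p∈

pointsFrom-≥ : ∀ b q w {p} → p ∈ pointsFrom q w → coord b q ≤ coord b p
pointsFrom-≥ b q []      (here refl) = ≤-refl
pointsFrom-≥ b q (a ∷ w) p∈ with subst (_ ∈_) (pointsFrom-∷ q a w) p∈
... | here refl = ≤-refl
... | there p∈′ = ≤-trans (coord-move-≤ a b q) (pointsFrom-≥ b (move a q) w p∈′)

OnRay : Step → Point → Point → Set
OnRay a p c = coord (opp a) c ≡ coord (opp a) p × coord a p ≤ coord a c

OnRay-refl : ∀ a p → OnRay a p p
OnRay-refl a p = refl , ≤-refl

OnRay-trans : ∀ a {p c d} → OnRay a p c → OnRay a c d → OnRay a p d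
OnRay-trans a (c≡p , p≤c) (d≡c , c≤d) = trans d≡c c≡p , ≤-trans p≤c c≤d

OnRay-step : ∀ a p → OnRay a p (move a p)
OnRay-step a p = coord-move-opp a p , ≤-trans (n≤1+n _) (≤-reflexive (sym (coord-move-self a p)))

OnRay-move : ∀ a {p c} → OnRay a p c → OnRay a (move a p) (move a c)
OnRay-move a {p} {c} (c≡p , p≤c) =
  trans (coord-move-opp a c) (trans c≡p (sym (coord-move-opp a p))) ,
  subst₂ _≤_ (sym (coord-move-self a p)) (sym (coord-move-self a c)) (s≤s p≤c)

ray∉pointsFrom : ∀ a q P y {c} → OnRay a (move a (move a (endFrom q P))) c →
                 c ∉ pointsFrom q (P ++ a ∷ opp a ∷ y)
ray∉pointsFrom a q P y {c} (c-level , c-far) c∈ =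
  excluded (∈-++⁻ (trail q P) (subst (c ∈_) (trans (pointsFrom-++ q P _) (cong (trail q P ++_) turn)) c∈))
  where
  e  = endFrom q P
  eₐ = move a e
  turn : pointsFrom e (a ∷ opp a ∷ y) ≡ e ∷ eₐ ∷ pointsFrom (move (opp a) eₐ) y
  turn = trans (pointsFrom-∷ e a _) (cong (e ∷_) (pointsFrom-∷ eₐ (opp a) y))
  level : coord (opp a) c ≡ coord (opp a) e
  level = trans c-level (trans (coord-move-opp a eₐ) (coord-move-opp a e))
  far : 2 + coord a e ≤ coord a c
  far = subst (_≤ coord a c) (trans (coord-move-self a eₐ) (cong suc (coord-move-self a e))) c-far
  beyond-eₐ : ¬ coord a c ≤ coord a eₐ
  beyond-eₐ c≤eₐ = <⇒≱ far (≤-trans c≤eₐ (≤-reflexive (coord-move-self a e)))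
  excluded : c ∈ trail q P ⊎ c ∈ e ∷ eₐ ∷ pointsFrom (move (opp a) eₐ) y → ⊥
  excluded (inj₁ c∈trail) = beyond-eₐ (≤-trans (trail-≤-endFrom a q P c∈trail) (coord-move-≤ a a e))
  excluded (inj₂ (here c≡e)) = beyond-eₐ (≤-trans (≤-reflexive (cong (coord a) c≡e)) (coord-move-≤ a a e))
  excluded (inj₂ (there (here c≡eₐ))) = beyond-eₐ (≤-reflexive (cong (coord a) c≡eₐ))
  excluded (inj₂ (there (there c∈tail))) =
    1+n≰n (subst₂ _≤_ (trans (coord-move-self (opp a) eₐ) (cong suc (coord-move-opp a e))) level
                      (pointsFrom-≥ (opp a) (move (opp a) eₐ) y c∈tail))

∈-replace : ∀ {A : Set} (T : List A) {S c d p} → p ∈ T ++ c ∷ S → p ≢ c → p ∈ T ++ d ∷ S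
∈-replace []      (here p≡c) p≢c = ⊥-elim (p≢c p≡c)
∈-replace []      (there p∈) _   = there p∈
∈-replace (t ∷ T) (here p≡t) _   = here p≡t
∈-replace (t ∷ T) (there p∈) p≢c = there (∈-replace T p∈ p≢c)

intersectIsDelete : ∀ {E F : List Point} {x} → x ∉ E → (∀ {p} → p ∈ F → p ≢ x → p ∈ E) →
                    IntersectIsDelete E F x
intersectIsDelete x∉E F∖x⊆E p =
  (λ (p∈E , p∈F) → p∈F , λ { refl → x∉E p∈E }) ,
  (λ (p∈F , p≢x) → F∖x⊆E p∈F p≢x , p∈F)

corner : Step → List Step → Point
corner a P = move a (move a (endFrom origin P))

peak∈r : ∀ {n} (G : Dyck n) P a r → word G ≡ P ++ a ∷ a ∷ opp a ∷ r → InR n G (corner a P)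
peak∈r {n} G P a r eq =
  subst (corner a P ∈_) (sym verticesG) (∈-++⁺ʳ T (here refl)) ,
  E ,
  peakFlip-<Ω {n} P a r eq (length-word G) ,
  intersectIsDelete (ray∉pointsFrom a origin P (a ∷ r) (OnRay-refl a (corner a P))) G∖corner⊆E
  where
  E = peakFlip G P a r eq
  e = endFrom origin P
  T = trail origin P ++ e ∷ move a e ∷ []
  rest = pointsFrom (move (opp a) (corner a P)) r
  verticesG : facet G ≡ T ++ corner a P ∷ rest
  verticesG = trans (cong (pointsFrom origin) eq) (pointsFrom-window origin P a a (opp a) r)
  verticesE : facet E ≡ T ++ move (opp a) (move a e) ∷ rest
  verticesE = trans (pointsFrom-window origin P a (opp a) a r)
                    (cong (λ z → T ++ move (opp a) (move a e) ∷ pointsFrom z r) (move-comm a (opp a) (move a e)))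
  G∖corner⊆E : ∀ {p} → p ∈ facet G → p ≢ corner a P → p ∈ facet E
  G∖corner⊆E p∈G = subst (_ ∈_) (sym verticesE) ∘′ ∈-replace T (subst (_ ∈_) verticesG p∈G)

firstPeak : ∀ a q P x → opp a ∈ x →
  Σ (List Step) λ Q → Σ (List Step) λ r →
    (P ++ a ∷ a ∷ x ≡ Q ++ a ∷ a ∷ opp a ∷ r) × OnRay a (endFrom q P) (endFrom q Q)
firstPeak a q P (b ∷ x) ā∈ with ≡-or-opp a b
... | inj₂ refl = P , x , refl , OnRay-refl a (endFrom q P)
... | inj₁ refl with ā∈
...   | here ā≡a = ⊥-elim (opp≢ a ā≡a)
...   | there ā∈x with firstPeak a q (P ++ a ∷ []) x ā∈x
...     | Q , r , eq , ray =
  Q , r , trans (sym (++-assoc P (a ∷ []) _)) eq ,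
  OnRay-trans a (subst (OnRay a (endFrom q P)) (sym (endFrom-∷ʳ q P a)) (OnRay-step a (endFrom q P))) ray

record Fork (xs ys : List Step) : Set where
  constructor fork
  field
    stem   : List Step
    letter : Step
    restˡ  : List Step
    restʳ  : List Step
    xs≡    : xs ≡ stem ++ letter ∷ letter ∷ restˡ
    ys≡    : ys ≡ stem ++ letter ∷ opp letter ∷ restʳ

Fork-∷ : ∀ c {xs ys} → Fork xs ys → Fork (c ∷ xs) (c ∷ ys)
Fork-∷ c (fork P a x y xs≡ ys≡) = fork (c ∷ P) a x y (cong (c ∷_) xs≡) (cong (c ∷_) ys≡)

diverge : ∀ c xs ys → length xs ≡ length ys → xs ≡ ys ⊎ Fork (c ∷ xs) (c ∷ ys) ⊎ Fork (c ∷ ys) (c ∷ xs)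
diverge c []       []       _   = inj₁ refl
diverge c (v ∷ xs) (v ∷ ys) len = map (cong (v ∷_)) (map (Fork-∷ c) (Fork-∷ c)) (diverge v xs ys (suc-injective len))
diverge c (h ∷ xs) (h ∷ ys) len = map (cong (h ∷_)) (map (Fork-∷ c) (Fork-∷ c)) (diverge h xs ys (suc-injective len))
diverge v (v ∷ xs) (h ∷ ys) _   = inj₂ (inj₁ (fork [] v xs ys refl refl))
diverge h (h ∷ xs) (v ∷ ys) _   = inj₂ (inj₁ (fork [] h xs ys refl refl))
diverge v (h ∷ xs) (v ∷ ys) _   = inj₂ (inj₂ (fork [] v ys xs refl refl))
diverge h (v ∷ xs) (h ∷ ys) _   = inj₂ (inj₂ (fork [] h ys xs refl refl))

opp∈-after-repeat : ∀ P a x y → count (opp a) (P ++ a ∷ a ∷ x) ≡ count (opp a) (P ++ a ∷ opp a ∷ y) →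
                    opp a ∈ x
opp∈-after-repeat P a x y balance = count≡suc⇒∈ ā x (+-cancelˡ-≡ (count ā P) _ _ (begin
  count ā P + count ā x              ≡⟨ cong (count ā P +_) (trans (count-∷-opp a (a ∷ x)) (count-∷-opp a x)) ⟨
  count ā P + count ā (a ∷ a ∷ x)    ≡⟨ count-++ ā P _ ⟨
  count ā (P ++ a ∷ a ∷ x)           ≡⟨ balance ⟩
  count ā (P ++ a ∷ ā ∷ y)           ≡⟨ count-++ ā P _ ⟩
  count ā P + count ā (a ∷ ā ∷ y)    ≡⟨ cong (count ā P +_) (trans (count-∷-opp a (ā ∷ y)) (count-∷-self ā y)) ⟩
  count ā P + suc (count ā y)        ∎))
  where ā = opp a

count-agree : ∀ {n} (X Y : Dyck n) b → count b (word X) ≡ count b (word Y)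
count-agree X Y b = trans (count-word X b) (sym (count-word Y b))

Fork⇒¬RSubset : ∀ {n} (X Y : Dyck n) → Fork (word X) (word Y) → ¬ RSubset n X Y
Fork⇒¬RSubset X Y (fork P a x y X≡ Y≡) r[X]⊆Y
  with firstPeak a origin P x (opp∈-after-repeat P a x y
         (subst₂ (λ u w → count (opp a) u ≡ count (opp a) w) X≡ Y≡ (count-agree X Y (opp a))))
... | Q , r , X≡′ , P→Q =
  ray∉pointsFrom a origin P y (OnRay-move a (OnRay-move a P→Q))
    (subst (corner a Q ∈_) (cong (pointsFrom origin) Y≡) (r[X]⊆Y (corner a Q) (peak∈r X Q a r (trans X≡ X≡′))))

theorem3p5 : ∀ (n : ℕ) → 1 ≤ n → IsPreShelling n
theorem3p5 n 1≤n F G r[F]⊆G r[G]⊆F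
  with word-startsWith-v F 1≤n | word-startsWith-v G 1≤n
... | f , F≡ | g , G≡
  with diverge v f g (suc-injective (subst₂ (λ u w → length u ≡ length w) F≡ G≡ (length-agree F G)))
... | inj₁ f≡g        = trans F≡ (trans (cong (v ∷_) f≡g) (sym G≡))
... | inj₂ (inj₁ F⋔G) = ⊥-elim (Fork⇒¬RSubset F G (subst₂ Fork (sym F≡) (sym G≡) F⋔G) r[F]⊆G)
... | inj₂ (inj₂ G⋔F) = ⊥-elim (Fork⇒¬RSubset G F (subst₂ Fork (sym G≡) (sym F≡) G⋔F) r[G]⊆F)
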